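{- Let $m \ge 2$ be an integer and let $f:\{0,1\}^n \to \{0,1\}$ be a Boolean function. Then the weak mod-$m$ degree of $f$ equals the minimum, over all prime factors $p$ of $m$, of the weak mod-$p$ degree of $f$.
   Context: For an integer $r \ge 2$, a polynomial $g \in \mathbb{Z}[x_1,\ldots,x_n]$ weakly represents $f$ mod $r$ if (i) for all $x\in\{0,1\}^n$, $f(x) = 0$ implies $g(x) \equiv 0 \pmod r$, and (ii) there is some $x \in \{0,1\}^n$ with $g(x) \not\equiv 0 \pmod r$. The weak mod-$r$ degree of $f$ is the minimum degree of a (multilinear) polynomial $g\in\mathbb{Z}[x_1,\ldots,x_n]$ weakly representing $f$ mod $r$ (taken to be $+\infty$ if none exists). -}

module Defs where

open import Data.Bool using (Bool; true; false; if_then_else_)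
open import Data.Nat as ℕ using (ℕ; zero; suc)
open import Data.Integer as ℤ using (ℤ; +_)
open import Data.Integer.Divisibility as ℤD using ()
open import Data.List using (List; []; _∷_; _++_; map; foldr)
open import Data.Vec using (Vec; []; _∷_)
open import Data.Product using (Σ; _×_; ∃)
open import Relation.Binary.PropositionalEquality using (_≡_)
open import Relation.Nullary using (¬_)

-- Points of the Boolean cube {0,1}^n (true = 1, false = 0).
Cube : ℕ → Set
Cube n = Vec Bool n

BoolFun : ℕ → Set
BoolFun n = Cube n → Bool

allPoints : (n : ℕ) → List (Cube n)
allPoints zero = [] ∷ []
allPoints (suc n) = map (false ∷_) (allPoints n) ++ map (true ∷_) (allPoints n)

-- A multilinear polynomial in ℤ[x₁,…,xₙ]: a coefficient for every monomial
-- ∏_{i ∈ S} xᵢ, where S ⊆ {1..n} is given by its characteristic vector.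
MLPoly : ℕ → Set
MLPoly n = Cube n → ℤ

monomial : ∀ {n} → Cube n → Cube n → ℤ
monomial [] [] = + 1
monomial (false ∷ S) (_ ∷ x) = monomial S x
monomial (true ∷ S) (b ∷ x) = (if b then + 1 else + 0) ℤ.* monomial S x

eval : ∀ {n} → MLPoly n → Cube n → ℤ
eval {n} g x = foldr ℤ._+_ (+ 0) (map (λ S → g S ℤ.* monomial S x) (allPoints n))

size : ∀ {n} → Cube n → ℕ
size [] = 0
size (false ∷ S) = size S
size (true ∷ S) = suc (size S)

-- deg g ≤ d  (the zero polynomial has degree ≤ d for every d)
DegreeAtMost : ∀ {n} → MLPoly n → ℕ → Set
DegreeAtMost g d = ∀ S → ¬ (g S ≡ + 0) → size S ℕ.≤ d

WeaklyRepresents : ∀ {n} → ℕ → MLPoly n → BoolFun n → Set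
WeaklyRepresents {n} r g f =
  (∀ (x : Cube n) → f x ≡ false → (+ r) ℤD.∣ eval g x)
  × ∃ λ (x : Cube n) → ¬ ((+ r) ℤD.∣ eval g x)

-- The weak mod-r degree (in ℕ ∪ {∞}) is the least d with
-- this property (∞ if there is none); it is determined by these sublevel sets.
WeakDegAtMost : ∀ {n} → ℕ → BoolFun n → ℕ → Set
WeakDegAtMost {n} r f d = ∃ λ (g : MLPoly n) → DegreeAtMost g d × WeaklyRepresents r g f

-- If g weakly represents f mod r and p is a prime factor of r, either some value of g
-- is nonzero mod p, and then g weakly represents f mod p, or p divides every value of g.
-- In the latter case p divides every coefficient (a multilinear polynomial is recovered
-- from its values on the cube), and g / p weakly represents f mod r / p with no larger
-- degree; running through the prime factorisation of m ends in the first case.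
-- Conversely, if g weakly represents f mod p and m = q p, then q g weakly represents f mod m.
module Submission where

open import Defs
open import Data.Nat using (ℕ; _≤_)
open import Data.Nat.Divisibility using (_∣_)
open import Data.Nat.Primality using (Prime)
open import Data.Product using (∃; _×_)
open import Function.Bundles using (_⇔_)

import Data.Integer.Properties as Z
open import Algebra.Properties.CommutativeSemigroup Z.*-commutativeSemigroup using (xy∙z≈xz∙y)
open import Data.Bool using (false; true)
open import Data.Empty using (⊥-elim)
open import Data.Integer as ℤ using (ℤ; +_; _+_; _*_)
open import Data.Integer.Divisibility as ℤᵘ using ()
open import Data.Integer.Divisibility.Signed as ℤˢ using ()
open import Data.List using (List; []; _∷_; _++_; map; foldr)
open import Data.List.Relation.Unary.All using (All; []; _∷_)
open import Data.Nat as ℕ using (NonZero)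
open import Data.Nat.Divisibility as ℕᵈ using (divides)
open import Data.Nat.ListAction using (product)
open import Data.Nat.Primality using (prime⇒nonZero)
open import Data.Nat.Primality.Factorisation using (factorise; PrimeFactorisation)
open import Data.Nat.Properties as ℕᵖ using ()
open import Data.Product using (_,_)
open import Data.Sum using (_⊎_; inj₁; inj₂)
open import Data.Vec using (_∷_; [])
open import Function using (_∘_)
open import Function.Bundles using (mk⇔; Equivalence)
open import Relation.Binary.PropositionalEquality
open import Relation.Nullary using (¬_; Dec; yes; no)

∑ : ∀ {A : Set} → List A → (A → ℤ) → ℤ
∑ L F = foldr _+_ (+ 0) (map F L)

∑-++ : ∀ {A : Set} (L L′ : List A) (F : A → ℤ) → ∑ (L ++ L′) F ≡ ∑ L F + ∑ L′ F
∑-++ [] L′ F = sym (Z.+-identityˡ _)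
∑-++ (a ∷ L) L′ F = trans (cong (_+_ (F a)) (∑-++ L L′ F)) (sym (Z.+-assoc (F a) _ _))

∑-map : ∀ {A B : Set} (h : A → B) (L : List A) (F : B → ℤ) → ∑ (map h L) F ≡ ∑ L (F ∘ h)
∑-map h [] F = refl
∑-map h (a ∷ L) F = cong (_+_ (F (h a))) (∑-map h L F)

∑-cong : ∀ {A : Set} (L : List A) {F G : A → ℤ} → (∀ a → F a ≡ G a) → ∑ L F ≡ ∑ L G
∑-cong [] F≗G = refl
∑-cong (a ∷ L) F≗G = cong₂ _+_ (F≗G a) (∑-cong L F≗G)

∑-zero : ∀ {A : Set} (L : List A) → ∑ L (λ _ → + 0) ≡ + 0
∑-zero [] = refl
∑-zero (a ∷ L) = trans (Z.+-identityˡ _) (∑-zero L)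

∑-*ʳ : ∀ {A : Set} (L : List A) (F : A → ℤ) (c : ℤ) → ∑ L F * c ≡ ∑ L (λ a → F a * c)
∑-*ʳ [] F c = Z.*-zeroˡ c
∑-*ʳ (a ∷ L) F c = trans (Z.*-distribʳ-+ c (F a) (∑ L F)) (cong (_+_ (F a * c)) (∑-*ʳ L F c))

eval-scale : ∀ {n} {g h : MLPoly n} (c : ℤ) → (∀ S → h S ≡ g S * c) →
             ∀ x → eval h x ≡ eval g x * c
eval-scale {n} {g} {h} c h≡gc x = begin
  ∑ (allPoints n) (λ S → h S * monomial S x)      ≡⟨ ∑-cong (allPoints n) reorder ⟩
  ∑ (allPoints n) (λ S → g S * monomial S x * c)  ≡⟨ ∑-*ʳ (allPoints n) _ c ⟨
  eval g x * c                                     ∎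
  where
  open ≡-Reasoning
  reorder : ∀ S → h S * monomial S x ≡ g S * monomial S x * c
  reorder S = trans (cong (_* monomial S x) (h≡gc S)) (xy∙z≈xz∙y (g S) c (monomial S x))

module _ {n : ℕ} (g : MLPoly (ℕ.suc n)) where

  g₀ g₁ : MLPoly n
  g₀ = g ∘ (false ∷_)
  g₁ = g ∘ (true ∷_)

  eval-∷ : ∀ b x → eval g (b ∷ x) ≡
           eval g₀ x + ∑ (allPoints n) (λ S → g₁ S * monomial (true ∷ S) (b ∷ x))
  eval-∷ b x = trans (∑-++ (map (false ∷_) A) (map (true ∷_) A) F)
                     (cong₂ _+_ (∑-map (false ∷_) A F) (∑-map (true ∷_) A F))
    where
    A : List (Cube n)
    A = allPoints n
    F : Cube (ℕ.suc n) → ℤ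
    F S = g S * monomial S (b ∷ x)

  eval-false∷ : ∀ x → eval g (false ∷ x) ≡ eval g₀ x
  eval-false∷ x = begin
    eval g (false ∷ x)                                               ≡⟨ eval-∷ false x ⟩
    eval g₀ x + ∑ (allPoints n) (λ S → g₁ S * (+ 0 * monomial S x))  ≡⟨ cong (_+_ (eval g₀ x)) vanishes ⟩
    eval g₀ x + + 0                                                  ≡⟨ Z.+-identityʳ _ ⟩
    eval g₀ x                                                        ∎
    where
    open ≡-Reasoning
    vanishes : ∑ (allPoints n) (λ S → g₁ S * (+ 0 * monomial S x)) ≡ + 0
    vanishes = trans (∑-cong (allPoints n) (λ S → Z.*-zeroʳ (g₁ S))) (∑-zero (allPoints n))

  eval-true∷ : ∀ x → eval g (true ∷ x) ≡ eval g₀ x + eval g₁ x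
  eval-true∷ x = trans (eval-∷ true x) (cong (_+_ (eval g₀ x)) (∑-cong (allPoints n) drop-one))
    where
    drop-one : ∀ S → g₁ S * (+ 1 * monomial S x) ≡ g₁ S * monomial S x
    drop-one S = cong (g₁ S *_) (Z.*-identityˡ (monomial S x))

-- Möbius inversion on the cube, one coordinate at a time: g(0∷x) = g₀(x) and
-- g(1∷x) − g(0∷x) = g₁(x).
∣values⇒∣coefficients : ∀ {n} (k : ℤ) (g : MLPoly n) →
                        (∀ x → k ℤˢ.∣ eval g x) → ∀ S → k ℤˢ.∣ g S
∣values⇒∣coefficients k g k∣g [] =
  subst (k ℤˢ.∣_) (trans (Z.+-identityʳ _) (Z.*-identityʳ _)) (k∣g [])
∣values⇒∣coefficients k g k∣g (false ∷ S) =
  ∣values⇒∣coefficients k (g₀ g) (λ x → subst (k ℤˢ.∣_) (eval-false∷ g x) (k∣g (false ∷ x))) S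
∣values⇒∣coefficients k g k∣g (true ∷ S) = ∣values⇒∣coefficients k (g₁ g) k∣g₁ S
  where
  k∣g₁ : ∀ x → k ℤˢ.∣ eval (g₁ g) x
  k∣g₁ x = ℤˢ.∣m+n∣m⇒∣n (subst (k ℤˢ.∣_) (eval-true∷ g x) (k∣g (true ∷ x)))
                        (subst (k ℤˢ.∣_) (eval-false∷ g x) (k∣g (false ∷ x)))

cube-∀⊎∃¬ : ∀ {n} (P : Cube n → Set) → (∀ x → Dec (P x)) → (∀ x → P x) ⊎ ∃ λ x → ¬ P x
cube-∀⊎∃¬ {ℕ.zero} P P? with P? []
... | yes p = inj₁ λ { [] → p }
... | no ¬p = inj₂ ([] , ¬p)
cube-∀⊎∃¬ {ℕ.suc n} P P? with cube-∀⊎∃¬ (P ∘ (false ∷_)) (P? ∘ (false ∷_))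
                              | cube-∀⊎∃¬ (P ∘ (true ∷_)) (P? ∘ (true ∷_))
... | inj₂ (x , ¬p) | _             = inj₂ (false ∷ x , ¬p)
... | inj₁ _        | inj₂ (x , ¬p) = inj₂ (true ∷ x , ¬p)
... | inj₁ p₀       | inj₁ p₁       = inj₁ λ { (false ∷ x) → p₀ x ; (true ∷ x) → p₁ x }

∣-*-cancel : ∀ r q .{{_ : NonZero q}} (a : ℤ) → + (r ℕ.* q) ℤᵘ.∣ a * + q ⇔ + r ℤᵘ.∣ a
∣-*-cancel r q a = subst (λ k → k ℤᵘ.∣ a * + q ⇔ + r ℤᵘ.∣ a) (sym (Z.pos-* r q))
  (mk⇔ (ℤᵘ.*-cancelʳ-∣ (+ q) {+ r} {a}) (ℤᵘ.*-monoˡ-∣ (+ q) {+ r} {a}))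

module _ {n : ℕ} (g h : MLPoly n) (q : ℕ) .{{_ : NonZero q}} (h≡gq : ∀ S → h S ≡ g S * + q) where

  degreeAtMost-scale : ∀ d → DegreeAtMost h d ⇔ DegreeAtMost g d
  degreeAtMost-scale d = mk⇔ (λ deg S gS≢0 → deg S (gS≢0 ∘ hS≡0⇒gS≡0 S))
                             (λ deg S hS≢0 → deg S (hS≢0 ∘ gS≡0⇒hS≡0 S))
    where
    hS≡0⇒gS≡0 : ∀ S → h S ≡ + 0 → g S ≡ + 0
    hS≡0⇒gS≡0 S hS≡0 = Z.*-cancelʳ-≡ (g S) (+ 0) (+ q) (trans (sym (h≡gq S)) hS≡0)
    gS≡0⇒hS≡0 : ∀ S → g S ≡ + 0 → h S ≡ + 0
    gS≡0⇒hS≡0 S gS≡0 = trans (h≡gq S) (cong (_* + q) gS≡0)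

  weaklyRepresents-scale : ∀ r (f : BoolFun n) →
                           WeaklyRepresents (r ℕ.* q) h f ⇔ WeaklyRepresents r g f
  weaklyRepresents-scale r f = mk⇔
    (λ (zeros , x , ∤hx) → (λ x fx≡0 → to (∣h x) (zeros x fx≡0)) , x , ∤hx ∘ from (∣h x))
    (λ (zeros , x , ∤gx) → (λ x fx≡0 → from (∣h x) (zeros x fx≡0)) , x , ∤gx ∘ to (∣h x))
    where
    open Equivalence
    ∣h : ∀ x → + (r ℕ.* q) ℤᵘ.∣ eval h x ⇔ + r ℤᵘ.∣ eval g x
    ∣h x rewrite eval-scale {g = g} {h} (+ q) h≡gq x = ∣-*-cancel r q (eval g x)

weakDegAtMost-∣ : ∀ {n} {f : BoolFun n} {d r m} .{{_ : NonZero m}} →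
                  r ∣ m → WeakDegAtMost r f d → WeakDegAtMost m f d
weakDegAtMost-∣ {n} {f} {d} {r} {m} (divides q m≡qr) (g , deg , rep) =
  h , from (degreeAtMost-scale g h q h≡gq d) deg ,
  subst (λ k → WeaklyRepresents k h f) (trans (ℕᵖ.*-comm r q) (sym m≡qr))
        (from (weaklyRepresents-scale g h q h≡gq r f) rep)
  where
  open Equivalence
  instance
    q-nonZero : NonZero q
    q-nonZero = ℕ.≢-nonZero λ { refl → ℕ.≢-nonZero⁻¹ m m≡qr }
  h : MLPoly n
  h S = g S * + q
  h≡gq : ∀ S → h S ≡ g S * + q
  h≡gq S = refl

weakDegAtMost-divideOut : ∀ {n} {f : BoolFun n} {d r} {g : MLPoly n} p .{{_ : NonZero p}} →
                          (∀ x → + p ℤᵘ.∣ eval g x) → DegreeAtMost g d →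
                          WeaklyRepresents (r ℕ.* p) g f → WeakDegAtMost r f d
weakDegAtMost-divideOut {f = f} {d} {r} {g} p p∣g deg rep =
  g′ , to (degreeAtMost-scale g′ g p g≡g′p d) deg , to (weaklyRepresents-scale g′ g p g≡g′p r f) rep
  where
  open Equivalence
  p∣coeff : ∀ S → + p ℤˢ.∣ g S
  p∣coeff = ∣values⇒∣coefficients (+ p) g (ℤˢ.∣ᵤ⇒∣ ∘ p∣g)
  g′ : MLPoly _
  g′ S = ℤˢ._∣_.quotient (p∣coeff S)
  g≡g′p : ∀ S → g S ≡ g′ S * + p
  g≡g′p S = ℤˢ._∣_.equality (p∣coeff S)

weakDegAtMost-primeFactor : ∀ {n} {f : BoolFun n} {d} (ps : List ℕ) → All Prime ps →
                            WeakDegAtMost (product ps) f d →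
                            ∃ λ p → Prime p × p ∣ product ps × WeakDegAtMost p f d
weakDegAtMost-primeFactor [] [] (_ , _ , _ , _ , ∤g) = ⊥-elim (∤g (ℕᵈ.1∣ _))
weakDegAtMost-primeFactor {f = f} {d} (p ∷ ps) (p-prime ∷ primes) (g , deg , zeros , x , ∤gx)
  with cube-∀⊎∃¬ (λ x → + p ℤᵘ.∣ eval g x) (λ x → p ℕᵈ.∣? ℤ.∣ eval g x ∣)
... | inj₂ (y , ∤gy) =
  p , p-prime , p∣r , g , deg , (λ x fx≡0 → ℕᵈ.∣-trans p∣r (zeros x fx≡0)) , y , ∤gy
  where
  p∣r : p ∣ p ℕ.* product ps
  p∣r = ℕᵈ.m∣m*n (product ps)
... | inj₁ p∣g =
  let q , q-prime , q∣ps , weak = weakDegAtMost-primeFactor ps primes divided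
  in  q , q-prime , ℕᵈ.∣-trans q∣ps (ℕᵈ.n∣m*n p) , weak
  where
  instance
    p-nonZero : NonZero p
    p-nonZero = prime⇒nonZero p-prime
  divided : WeakDegAtMost (product ps) f d
  divided = weakDegAtMost-divideOut p p∣g deg
    (subst (λ k → WeaklyRepresents k g f) (ℕᵖ.*-comm p (product ps)) (zeros , x , ∤gx))

mainTheorem4 : (m : ℕ) → 2 ≤ m → (n : ℕ) → (f : BoolFun n) → (d : ℕ) →
    WeakDegAtMost m f d ⇔ (∃ λ (p : ℕ) → Prime p × p ∣ m × WeakDegAtMost p f d)
mainTheorem4 m 2≤m n f d = mk⇔ viaFactorisation (λ (p , _ , p∣m , weak) → weakDegAtMost-∣ p∣m weak)
  where
  instance
    m-nonZero : NonZero m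
    m-nonZero = ℕ.>-nonZero (ℕᵖ.<-≤-trans (ℕ.s≤s ℕ.z≤n) 2≤m)
  open PrimeFactorisation (factorise m)
  viaFactorisation : WeakDegAtMost m f d → ∃ λ p → Prime p × p ∣ m × WeakDegAtMost p f d
  viaFactorisation weak rewrite isFactorisation = weakDegAtMost-primeFactor factors factorsPrime weak
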